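{- There exists no graph $G$ such that $\gamma_{\rm gr}^t(G)=3$.
   Context: All graphs are finite and simple. For a vertex $v$, $N(v)$ is its open neighborhood. A sequence $(v_1,\ldots,v_k)$ of distinct vertices is legal if for every $i\in\{1,\ldots,k\}$, $N(v_i)\setminus\bigcup_{j=1}^{i-1}N(v_j)\neq\emptyset$; it is a total dominating sequence if in addition every vertex has a neighbor among $v_1,\ldots,v_k$. $\gamma_{\rm gr}^t(G)$ is the maximum length of a legal sequence (for graphs with no isolated vertices, the maximum length of a total dominating sequence). -}

module Defs where

open import Data.Nat using (ℕ; _≤_)
open import Data.Fin using (Fin)
open import Data.Bool using (Bool; true; false; T)
open import Data.List using (List; []; _∷_; length)
open import Data.List.Relation.Unary.Unique.Propositional using (Unique)
open import Data.List.Relation.Unary.All using (All)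
open import Data.Product using (Σ; _×_; ∃)
open import Relation.Binary.PropositionalEquality using (_≡_)
open import Relation.Nullary using (¬_)

record Graph : Set where
  field
    n     : ℕ
    adj   : Fin n → Fin n → Bool
    sym   : ∀ u v → adj u v ≡ adj v u
    irrefl : ∀ v → adj v v ≡ false

open Graph public

Vertex : Graph → Set
Vertex G = Fin (n G)

Adj : (G : Graph) → Vertex G → Vertex G → Set
Adj G u v = T (adj G u v)

-- Legality, with the sequence stored in reverse order: the head is the
-- last chosen vertex, the tail is the earlier vertices.
-- N(v) \ ⋃_{w ∈ prev} N(w) ≠ ∅
Footprint : (G : Graph) → Vertex G → List (Vertex G) → Set
Footprint G v prev = ∃ λ u → Adj G v u × All (λ w → ¬ Adj G w u) prev

data LegalRev (G : Graph) : List (Vertex G) → Set where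
  []  : LegalRev G []
  _∷_ : ∀ {v prev} → Footprint G v prev → LegalRev G prev → LegalRev G (v ∷ prev)

Legal : (G : Graph) → List (Vertex G) → Set
Legal G s = Unique s × LegalRev G s

GrundyTotalDom : Graph → ℕ → Set
GrundyTotalDom G k =
  (Σ (List (Vertex G)) λ s → Legal G s × length s ≡ k) ×
  (∀ s → Legal G s → length s ≤ k)

-- Let (x, y, z) be legal, with footprints a of x, b of y (so x ≁ b) and c of z
-- (so x ≁ c, y ≁ c). If x ~ y then (c, x, y, z) is legal, with footprints
-- z, y, x, c; otherwise (x, y, b, a) is legal, with footprints a, b, y, x.
-- So every graph with a legal sequence of length 3 has one of length 4.
module Submission where

open import Defs
open import Data.Bool using (T; T?)
open import Data.List using ([]; _∷_; length)
open import Data.List.Relation.Unary.All as All using ([]; _∷_)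
open import Data.List.Relation.Unary.AllPairs using ([]; _∷_)
open import Data.List.Relation.Unary.Unique.Propositional using (Unique)
open import Data.Nat using (_≤_)
open import Data.Nat.Properties using (<-irrefl)
open import Data.Product using (∃; _×_; _,_)
open import Relation.Binary.PropositionalEquality using (_≡_; refl; subst)
open import Relation.Nullary using (¬_; yes; no)

module _ {G : Graph} where

  Adj-sym : ∀ {u v} → Adj G u v → Adj G v u
  Adj-sym {u} {v} = subst T (sym G u v)

  ¬Adj-sym : ∀ {u v} → ¬ Adj G u v → ¬ Adj G v u
  ¬Adj-sym u≁v v~u = u≁v (Adj-sym v~u)

  ¬Adj-refl : ∀ v → ¬ Adj G v v
  ¬Adj-refl v = subst T (irrefl G v)

  legalRev⇒unique : ∀ {s} → LegalRev G s → Unique s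
  legalRev⇒unique [] = []
  legalRev⇒unique ((u , v~u , prev≁u) ∷ legal) =
    All.map (λ w≁u v≡w → w≁u (subst (λ t → Adj G t u) v≡w v~u)) prev≁u
      ∷ legalRev⇒unique legal

  legalRev-3⇒legalRev-4 : ∀ {x y z} → LegalRev G (z ∷ y ∷ x ∷ []) →
                          ∃ λ s → LegalRev G s × length s ≡ 4
  legalRev-3⇒legalRev-4 {x} {y} {z}
    ((c , z~c , y≁c ∷ x≁c ∷ []) ∷ (b , y~b , x≁b ∷ []) ∷ (a , x~a , []) ∷ [])
    with T? (adj G x y)
  ... | yes x~y =
    z ∷ y ∷ x ∷ c ∷ [] ,
    (c , z~c , y≁c ∷ x≁c ∷ ¬Adj-refl c ∷ []) ∷
    (x , Adj-sym x~y , ¬Adj-refl x ∷ ¬Adj-sym x≁c ∷ []) ∷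
    (y , x~y , ¬Adj-sym y≁c ∷ []) ∷
    (z , Adj-sym z~c , []) ∷ [] ,
    refl
  ... | no x≁y =
    a ∷ b ∷ y ∷ x ∷ [] ,
    (x , Adj-sym x~a , ¬Adj-sym x≁b ∷ ¬Adj-sym x≁y ∷ ¬Adj-refl x ∷ []) ∷
    (y , Adj-sym y~b , ¬Adj-refl y ∷ x≁y ∷ []) ∷
    (b , y~b , x≁b ∷ []) ∷
    (a , x~a , []) ∷ [] ,
    refl

proposition3p9 : (G : Graph) → ¬ GrundyTotalDom G 3
proposition3p9 G ((_ ∷ _ ∷ _ ∷ [] , (_ , legal₃) , refl) , maximal)
  with legalRev-3⇒legalRev-4 legal₃
... | s , legal₄ , length≡4 =
  <-irrefl refl (subst (_≤ 3) length≡4 (maximal s (legalRev⇒unique legal₄ , legal₄)))
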